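{- Let $k\ge1$, and for $i=1,2$ let $n_i\ge 1$ and $t_i\ge 1$ be integers. If $n_1+n_2=n+1$ and $t_1+t_2=t+1$, then $p_{t_1}(n_1,k)+p_{t_2}(n_2,k)-1\le p_t(n,k)$.
   Context: For $n\ge 2$, $d=\lfloor (n-2)/k\rfloor+1$, $b=(n-2)-k(d-1)$, and $p_t(n,k)=\max\{t2^d+b,\ 2t+n-2\}$. By convention, $p_t(1,k)=t-1$ for every $k$. -}

module Defs where

open import Data.Nat using (ℕ; zero; suc; _+_; _*_; _∸_; _^_; _⊔_; NonZero)
open import Data.Nat.DivMod using (_/_)

-- Convention: p_t(1,k) = t - 1.  (n = 0 is outside the domain; we set it to 0 arbitrarily,
-- it is never used by the statement since n ≥ 1 there.)
-- Argument order: p t n k.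
p : ℕ → ℕ → (k : ℕ) → .{{NonZero k}} → ℕ
p t zero          k = 0
p t (suc zero)    k = t ∸ 1
p t (suc (suc m)) k = (t * 2 ^ d + b) ⊔ (2 * t + m)
  where
  d : ℕ
  d = m / k + 1
  b : ℕ
  b = m ∸ k * (d ∸ 1)

module Submission where

-- For n ≥ 2 write n = m + 2 and q = ⌊m/k⌋. Then p_t(n,k) is the maximum of
-- t·2^(j+1) + m − jk over 0 ≤ j ≤ q: since j ↦ t·2^(j+1) − jk is convex, the maximum
-- is taken at j = 0 or j = q, which are the two branches of the definition.
-- Choosing maximisers j₁, j₂ for the two summands, the index j₁ + j₂ is admissible
-- for n = n₁ + n₂ − 1, and  t₁X + t₂Y ≤ (t₁ + t₂ − 1)XY + 1  for X, Y ≥ 1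
-- compares the exponential parts. The cases n₁ = 1 or n₂ = 1 reduce to
-- monotonicity of p in t, which follows from the same description.

open import Defs
open import Data.Nat using (ℕ; zero; suc; _+_; _*_; _∸_; _^_; _≤_; _<_; z≤n; NonZero)
open import Data.Nat.Properties
open import Algebra.Properties.CommutativeSemigroup +-commutativeSemigroup using (xy∙z≈xz∙y; interchange)
open import Data.Nat.DivMod using (_/_; m/n*n≤m; /-monoˡ-≤; m*n/n≡m)
open import Data.Nat.Tactic.RingSolver using (solve-∀)
open import Data.Product using (_×_; _,_; ∃-syntax)
open import Data.Sum using (inj₁; inj₂)
open import Relation.Nullary using (yes; no)
open import Relation.Binary.PropositionalEquality using (_≡_; refl; sym; trans; cong; subst)

c+r*k≤c*2^r : ∀ {c k} r → k ≤ c → c + r * k ≤ c * 2 ^ r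
c+r*k≤c*2^r {c} zero    _   = ≤-reflexive (trans (+-identityʳ c) (sym (*-identityʳ c)))
c+r*k≤c*2^r {c} {k} (suc r) k≤c = begin
  c + (k + r * k)   ≡⟨ +-assoc c k (r * k) ⟨
  c + k + r * k     ≤⟨ +-monoˡ-≤ (r * k) (+-monoʳ-≤ c k≤c) ⟩
  c + c + r * k     ≤⟨ c+r*k≤c*2^r r (≤-trans k≤c (m≤m+n c c)) ⟩
  (c + c) * 2 ^ r   ≡⟨ double-shift c (2 ^ r) ⟩
  c * 2 ^ suc r     ∎
  where
  open ≤-Reasoning
  double-shift : ∀ c x → (c + c) * x ≡ c * (2 * x)
  double-shift = solve-∀

c*2^j≤c+j*k : ∀ {c k} j → c * 2 ^ j ≤ k → c * 2 ^ j ≤ c + j * k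
c*2^j≤c+j*k {c} zero    _ = ≤-reflexive (trans (*-identityʳ c) (sym (+-identityʳ c)))
c*2^j≤c+j*k {c} {k} (suc j) c2^1+j≤k = begin
  c * (2 * 2 ^ j)          ≡⟨ split c (2 ^ j) ⟩
  c * 2 ^ j + c * 2 ^ j    ≤⟨ +-mono-≤ (c*2^j≤c+j*k j c2^j≤k) c2^j≤k ⟩
  c + j * k + k            ≡⟨ regroup c (j * k) k ⟩
  c + (k + j * k)          ∎
  where
  open ≤-Reasoning
  split : ∀ c x → c * (2 * x) ≡ c * x + c * x
  split = solve-∀
  regroup : ∀ a b k → a + b + k ≡ a + (k + b)
  regroup = solve-∀
  c2^j≤k : c * 2 ^ j ≤ k
  c2^j≤k = ≤-trans (*-monoʳ-≤ c (m≤m+n (2 ^ j) (2 ^ j + 0))) c2^1+j≤k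

convexity : ∀ t {k j q} → j ≤ q → k ≤ t * 2 ^ suc j →
            t * 2 ^ suc j + q * k ≤ t * 2 ^ suc q + j * k
convexity t {k} {j} j≤q k≤c with r , refl ← m≤n⇒∃[o]m+o≡n j≤q = begin
  c + (j + r) * k       ≡⟨ cong (c +_) (*-distribʳ-+ k j r) ⟩
  c + (j * k + r * k)   ≡⟨ regroup c (j * k) (r * k) ⟩
  c + r * k + j * k     ≤⟨ +-monoˡ-≤ (j * k) (c+r*k≤c*2^r r k≤c) ⟩
  c * 2 ^ r + j * k     ≡⟨ cong (_+ j * k) shift ⟩
  t * 2 ^ suc (j + r) + j * k ∎
  where
  open ≤-Reasoning
  c = t * 2 ^ suc j
  regroup : ∀ c a b → c + (a + b) ≡ c + b + a
  regroup = solve-∀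
  shift : c * 2 ^ r ≡ t * 2 ^ suc (j + r)
  shift = trans (*-assoc t (2 ^ suc j) (2 ^ r)) (cong (t *_) (sym (^-distribˡ-+-* 2 (suc j) r)))

weighted-sum≤weighted-product : ∀ a c {X Y} → 1 ≤ X → 1 ≤ Y →
  suc a * (2 * X) + suc c * (2 * Y) ≤ suc (a + c) * (2 * (X * Y)) + 2
weighted-sum≤weighted-product a c {suc x} {suc y} _ _ = begin
  suc a * (2 * suc x) + suc c * (2 * suc y)
    ≤⟨ m≤m+n _ (2 * (x * y + a * y + a * x * y + c * x + c * x * y)) ⟩
  _ ≡⟨ expand a c x y ⟩
  suc (a + c) * (2 * (suc x * suc y)) + 2 ∎
  where
  open ≤-Reasoning
  expand : ∀ a c x y →
    suc a * (2 * suc x) + suc c * (2 * suc y) + 2 * (x * y + a * y + a * x * y + c * x + c * x * y)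
      ≡ suc (a + c) * (2 * (suc x * suc y)) + 2
  expand = solve-∀

module _ (k : ℕ) .{{_ : NonZero k}} where

  exponential-branch : ∀ t m →
    t * 2 ^ (m / k + 1) + (m ∸ k * (m / k + 1 ∸ 1)) + m / k * k ≡ t * 2 ^ suc (m / k) + m
  exponential-branch t m rewrite +-comm (m / k) 1 | *-comm k (m / k) =
    trans (+-assoc (t * 2 ^ suc (m / k)) _ _) (cong (t * 2 ^ suc (m / k) +_) (m∸n+n≡m (m/n*n≤m m k)))

  p-attained : ∀ t m → ∃[ j ] j * k ≤ m × p t (2 + m) k + j * k ≤ t * 2 ^ suc j + m
  p-attained t m with ≤-total (t * 2 ^ (m / k + 1) + (m ∸ k * (m / k + 1 ∸ 1))) (2 * t + m)
  ... | inj₁ A≤B rewrite m≤n⇒m⊔n≡n A≤B = 0 , z≤n , ≤-reflexive (linear-branch t m)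
    where
    linear-branch : ∀ t m → 2 * t + m + 0 * k ≡ t * 2 ^ 1 + m
    linear-branch = solve-∀
  ... | inj₂ B≤A rewrite m≥n⇒m⊔n≡m B≤A = m / k , m/n*n≤m m k , ≤-reflexive (exponential-branch t m)

  p-bound : ∀ t m j → j * k ≤ m → t * 2 ^ suc j + m ≤ p t (2 + m) k + j * k
  p-bound t m j jk≤m with k ≤? t * 2 ^ suc j
  ... | yes k≤c = +-cancelʳ-≤ (q * k) _ _ (begin
    t * 2 ^ suc j + m + q * k  ≡⟨ xy∙z≈xz∙y _ m (q * k) ⟩
    t * 2 ^ suc j + q * k + m  ≤⟨ +-monoˡ-≤ m (convexity t j≤q k≤c) ⟩
    t * 2 ^ suc q + j * k + m  ≡⟨ xy∙z≈xz∙y _ (j * k) m ⟩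
    t * 2 ^ suc q + m + j * k  ≡⟨ cong (_+ j * k) (exponential-branch t m) ⟨
    A + q * k + j * k          ≡⟨ xy∙z≈xz∙y A (q * k) (j * k) ⟩
    A + j * k + q * k          ≤⟨ +-monoˡ-≤ (q * k) (+-monoˡ-≤ (j * k) (m≤m⊔n A (2 * t + m))) ⟩
    p t (2 + m) k + j * k + q * k ∎)
    where
    open ≤-Reasoning
    q = m / k
    A = t * 2 ^ (q + 1) + (m ∸ k * (q + 1 ∸ 1))
    j≤q : j ≤ q
    j≤q = subst (_≤ q) (m*n/n≡m j k) (/-monoˡ-≤ k jk≤m)
  ... | no k≰c = begin
    t * 2 ^ suc j + m    ≡⟨ cong (_+ m) (reassociate t (2 ^ j)) ⟩
    2 * t * 2 ^ j + m    ≤⟨ +-monoˡ-≤ m (c*2^j≤c+j*k j 2t2^j≤k) ⟩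
    2 * t + j * k + m    ≡⟨ xy∙z≈xz∙y (2 * t) (j * k) m ⟩
    2 * t + m + j * k    ≤⟨ +-monoˡ-≤ (j * k) (m≤n⊔m _ (2 * t + m)) ⟩
    p t (2 + m) k + j * k ∎
    where
    open ≤-Reasoning
    reassociate : ∀ t x → t * (2 * x) ≡ 2 * t * x
    reassociate = solve-∀
    2t2^j≤k : 2 * t * 2 ^ j ≤ k
    2t2^j≤k = <⇒≤ (subst (_< k) (reassociate t (2 ^ j)) (≰⇒> k≰c))

  p-monoˡ : ∀ t a m → p t (2 + m) k + a ≤ p (t + a) (2 + m) k
  p-monoˡ t a m with j , jk≤m , attained ← p-attained t m = +-cancelʳ-≤ (j * k) _ _ (begin
    p t (2 + m) k + a + j * k    ≡⟨ xy∙z≈xz∙y _ a (j * k) ⟩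
    p t (2 + m) k + j * k + a    ≤⟨ +-monoˡ-≤ a attained ⟩
    t * X + m + a                ≡⟨ xy∙z≈xz∙y (t * X) m a ⟩
    t * X + a + m                ≤⟨ +-monoˡ-≤ m (+-monoʳ-≤ (t * X) (m≤m*n a X {{m^n≢0 2 (suc j)}})) ⟩
    t * X + a * X + m            ≡⟨ cong (_+ m) (*-distribʳ-+ X t a) ⟨
    (t + a) * X + m              ≤⟨ p-bound (t + a) m j jk≤m ⟩
    p (t + a) (2 + m) k + j * k  ∎)
    where
    open ≤-Reasoning
    X = 2 ^ suc j

  p-superadditive-≥2 : ∀ a c m₁ m₂ →
    p (suc a) (2 + m₁) k + p (suc c) (2 + m₂) k ≤ p (suc (a + c)) (3 + (m₁ + m₂)) k + 1
  p-superadditive-≥2 a c m₁ m₂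
    with j₁ , j₁k≤m₁ , attained₁ ← p-attained (suc a) m₁
       | j₂ , j₂k≤m₂ , attained₂ ← p-attained (suc c) m₂ = +-cancelʳ-≤ J _ _ (begin
    P₁ + P₂ + J                                              ≡⟨ cong (P₁ + P₂ +_) (*-distribʳ-+ k j₁ j₂) ⟩
    P₁ + P₂ + (j₁ * k + j₂ * k)                              ≡⟨ interchange P₁ P₂ (j₁ * k) (j₂ * k) ⟩
    (P₁ + j₁ * k) + (P₂ + j₂ * k)                            ≤⟨ +-mono-≤ attained₁ attained₂ ⟩
    suc a * 2 ^ suc j₁ + m₁ + (suc c * 2 ^ suc j₂ + m₂)      ≡⟨ interchange (suc a * 2 ^ suc j₁) m₁ (suc c * 2 ^ suc j₂) m₂ ⟩
    suc a * 2 ^ suc j₁ + suc c * 2 ^ suc j₂ + (m₁ + m₂)      ≤⟨ +-monoˡ-≤ (m₁ + m₂) exponential-parts ⟩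
    t * (2 * (2 ^ j₁ * 2 ^ j₂)) + 2 + (m₁ + m₂)              ≡⟨ cong (λ Z → t * (2 * Z) + 2 + (m₁ + m₂)) (^-distribˡ-+-* 2 j₁ j₂) ⟨
    t * 2 ^ suc (j₁ + j₂) + 2 + (m₁ + m₂)                    ≡⟨ shuffle (t * 2 ^ suc (j₁ + j₂)) (m₁ + m₂) ⟩
    t * 2 ^ suc (j₁ + j₂) + (1 + (m₁ + m₂)) + 1              ≤⟨ +-monoˡ-≤ 1 (p-bound t (1 + (m₁ + m₂)) (j₁ + j₂) J≤1+m₁+m₂) ⟩
    P + J + 1                                                ≡⟨ xy∙z≈xz∙y P J 1 ⟩
    P + 1 + J                                                ∎)
    where
    open ≤-Reasoning
    t = suc (a + c)
    J = (j₁ + j₂) * k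
    P₁ = p (suc a) (2 + m₁) k
    P₂ = p (suc c) (2 + m₂) k
    P = p t (3 + (m₁ + m₂)) k
    exponential-parts : suc a * 2 ^ suc j₁ + suc c * 2 ^ suc j₂ ≤ t * (2 * (2 ^ j₁ * 2 ^ j₂)) + 2
    exponential-parts = weighted-sum≤weighted-product a c (m^n>0 2 j₁) (m^n>0 2 j₂)
    shuffle : ∀ x s → x + 2 + s ≡ x + (1 + s) + 1
    shuffle = solve-∀
    J≤1+m₁+m₂ : J ≤ 1 + (m₁ + m₂)
    J≤1+m₁+m₂ = ≤-trans (≤-reflexive (*-distribʳ-+ k j₁ j₂)) (m≤n⇒m≤1+n (+-mono-≤ j₁k≤m₁ j₂k≤m₂))

  p-superadditive : ∀ a c n₁ n₂ →
    p (suc a) (suc n₁) k + p (suc c) (suc n₂) k ≤ p (suc (a + c)) (suc (n₁ + n₂)) k + 1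
  p-superadditive a c zero    zero    = m≤m+n (a + c) 1
  p-superadditive a c zero    (suc m₂) rewrite +-comm a c =
    ≤-trans (≤-reflexive (+-comm a _)) (≤-trans (p-monoˡ (suc c) a m₂) (m≤m+n _ 1))
  p-superadditive a c (suc m₁) zero    rewrite +-identityʳ m₁ =
    ≤-trans (p-monoˡ (suc a) c m₁) (m≤m+n _ 1)
  p-superadditive a c (suc m₁) (suc m₂) rewrite +-suc m₁ m₂ = p-superadditive-≥2 a c m₁ m₂

suc+suc≡n+1⇒n≡suc : ∀ {a b n} → suc a + suc b ≡ n + 1 → n ≡ suc (a + b)
suc+suc≡n+1⇒n≡suc {a} {b} {n} eq =
  suc-injective (trans (sym (+-comm n 1)) (trans (sym eq) (cong suc (+-suc a b))))

lemma24 : (k n t n₁ n₂ t₁ t₂ : ℕ) → .{{_ : NonZero k}} →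
          1 ≤ n₁ → 1 ≤ n₂ → 1 ≤ t₁ → 1 ≤ t₂ →
          n₁ + n₂ ≡ n + 1 → t₁ + t₂ ≡ t + 1 →
          p t₁ n₁ k + p t₂ n₂ k ≤ p t n k + 1
lemma24 k n t (suc n₁) (suc n₂) (suc a) (suc c) _ _ _ _ en et
  with refl ← suc+suc≡n+1⇒n≡suc en | refl ← suc+suc≡n+1⇒n≡suc et = p-superadditive k a c n₁ n₂
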